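{- Let $t\ge 1$ and $s\ge 2$ be integers. Then $\chi_p(P_{3t}\Diamond_3 C_{4s+2})\le 4$ if $1\le t\le 3$, and $\chi_p(P_{3t}\Diamond_3 C_{4s+2})\le 5$ if $t\ge 4$. Moreover, equality holds for $t\in\{1,2,3\}$.
   Context: A packing $k$-coloring of a graph $H$ is a map $c:V(H)\to\{1,\ldots,k\}$ such that any two distinct vertices $u,v$ with $c(u)=c(v)=i$ satisfy $d_H(u,v)\ge i+1$. The packing chromatic number $\chi_p(H)$ is the least such $k$. $P_m$ denotes the path $v_1\cdots v_m$ and $C_n$ the cycle on $n$ vertices. Path-aligned product: for positive integers $\ell\mid m$ and a connected vertex-transitive graph $G$ containing $P_\ell$ as a subgraph, $P_m\Diamond_\ell G$ is formed from the path $P_m=v_1\cdots v_m$ and $m/\ell$ pairwise disjoint copies of $G$, where for each $1\le i\le m/\ell$ the consecutive path vertices $v_{(i-1)\ell+1},\ldots,v_{i\ell}$ are identified, in order, with the vertices of a path $P_\ell$ (i.e. $\ell$ consecutive cycle vertices when $G$ is a cycle) in the $i$-th copy of $G$. -}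

module Defs where

open import Data.Nat using (ℕ; zero; suc; _<_; _∸_)
open import Data.Fin using (Fin; toℕ)
open import Data.Product using (_×_; _,_; ∃)
open import Data.Sum using (_⊎_)
open import Relation.Binary.PropositionalEquality using (_≡_; _≢_)
open import Relation.Nullary using (¬_)

record Graph : Set₁ where
  field
    V   : Set
    Adj : V → V → Set

open Graph public

data Walk (G : Graph) : V G → V G → ℕ → Set where
  nil  : ∀ {u} → Walk G u u zero
  cons : ∀ {u w v n} → Adj G u w → Walk G w v n → Walk G u v (suc n)

-- d_G(u,v) ≥ d : there is no walk (hence no path) from u to v of length < d.
DistAtLeast : (G : Graph) → ℕ → V G → V G → Set
DistAtLeast G d u v = ∀ n → n < d → ¬ Walk G u v n

-- Packing k-coloring: colour c u ∈ Fin k stands for colour toℕ (c u) + 1 ∈ {1..k};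
-- distinct vertices sharing colour i must satisfy d(u,v) ≥ i + 1.
IsPackingColoring : (G : Graph) (k : ℕ) → (V G → Fin k) → Set
IsPackingColoring G k c =
  ∀ u v → u ≢ v → c u ≡ c v → DistAtLeast G (suc (suc (toℕ (c u)))) u v

PackingColorable : Graph → ℕ → Set
PackingColorable G k = ∃ λ (c : V G → Fin k) → IsPackingColoring G k c

χp≤ : Graph → ℕ → Set
χp≤ G k = PackingColorable G k

χp≡ : Graph → ℕ → Set
χp≡ G k = PackingColorable G k × (∀ j → j < k → ¬ PackingColorable G j)

-- Path-aligned product P_{q·ℓ} ◇_ℓ C_n (with ℓ ≤ n).
-- Vertex (i , a) is vertex a of the i-th copy (0-based) of C_n, whose cycle
-- vertices are 0,1,...,n-1 in cyclic order.  Path vertex v_{iℓ+j+1} (0 ≤ j < ℓ)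
-- is identified with cycle vertex j of copy i, so the path edges inside a block
-- are cycle edges, and the remaining path edges join (i , ℓ-1) to (i+1 , 0).
data PCArc (q ℓ n : ℕ) : Fin q × Fin n → Fin q × Fin n → Set where
  cyc  : ∀ i (a b : Fin n) →
         (toℕ b ≡ suc (toℕ a) ⊎ (toℕ a ≡ n ∸ 1 × toℕ b ≡ 0)) →
         PCArc q ℓ n (i , a) (i , b)
  link : ∀ (i i' : Fin q) (a b : Fin n) → toℕ i' ≡ suc (toℕ i) →
         toℕ a ≡ ℓ ∸ 1 → toℕ b ≡ 0 →
         PCArc q ℓ n (i , a) (i' , b)

PathCycleProduct : (q ℓ n : ℕ) → Graph
PathCycleProduct q ℓ n = record
  { V   = Fin q × Fin n
  ; Adj = λ u v → PCArc q ℓ n u v ⊎ PCArc q ℓ n v u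
  }

P3t◇C : (t n : ℕ) → Graph
P3t◇C t n = PathCycleProduct t 3 n

{-# OPTIONS --safe #-}
module Submission where

-- Write n = 4s + 2 and let κ 1 2 1 3 1 2 1 3 … 1 be the cyclic word made of one colour
-- κ ≥ 4 followed by the first 4s + 1 letters of the periodic motif 1213. As 4s + 1 ≡ 1
-- (mod 4) the word has a 1 on both sides of κ, so the spacing of the motif survives the
-- wrap-around and every rotation of the word is a packing colouring of C_n. Giving each
-- copy of C_n a suitable rotation (κ = 4 in all of at most three copies; κ = 4 and κ = 5
-- alternating for arbitrarily many copies) keeps equal colours far apart across the
-- gluing vertices 0 and 2. Distances are bounded below by the length of the obvious
-- route, which changes by at most one along an edge.
--
-- Conversely, in a packing 3-colouring of a copy of C_n any two consecutive vertices
-- include a 1, so the colours 2 and 3 alternate on the remaining vertices and the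
-- colouring has period 4. Together with period n ≡ 2 (mod 4) this gives period 2,
-- which forces two adjacent vertices to both have colour 1.

open import Defs
open import Data.Nat
  using (ℕ; zero; suc; _+_; _*_; _∸_; _≤_; _<_; _⊓_; ∣_-_∣; _%_; _/_; _≟_; _≤?_; _<?_;
         NonZero; >-nonZero; z≤n; s≤s; z<s)
open import Data.Nat.Properties
open import Data.Nat.DivMod
  using (m≡m%n+[m/n]*n; m%n<n; m<n⇒m%n≡m; n%n≡0; m%n%n≡m%n; %-distribˡ-+; [m+n]%n≡m%n)
open import Data.Nat.Divisibility using (_∣_; divides; ∣⇒≤)
open import Data.Nat.Tactic.RingSolver using (solve-∀)
open import Data.Fin as Fin using (Fin; toℕ; fromℕ<; inject≤)
open import Data.Fin.Properties
  using (toℕ<n; toℕ-injective; toℕ-fromℕ<; toℕ-inject≤; inject≤-injective)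
open import Data.Fin.Patterns using (0F; 1F; 2F)
open import Data.Product using (_×_; _,_; proj₁; proj₂)
open import Data.Sum using (_⊎_; inj₁; inj₂; swap)
open import Data.Empty using (⊥; ⊥-elim)
open import Function using (_∘_)
open import Relation.Binary.Definitions using (tri<; tri≈; tri>)
open import Relation.Binary.PropositionalEquality
open import Relation.Nullary using (¬_; yes; no)
open import Relation.Nullary.Decidable using (from-yes; True; toWitness)

-- Distances and packing colourings in an arbitrary graph

module _ (G : Graph) where

  Lipschitz : (V G → ℕ) → Set
  Lipschitz φ = ∀ {v w} → Adj G v w → φ w ≤ suc (φ v)

  Lipschitz-walk : ∀ {φ} → Lipschitz φ → ∀ {u v m} → Walk G u v m → φ v ≤ φ u + m
  Lipschitz-walk {φ} _ {u} nil = m≤m+n (φ u) 0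
  Lipschitz-walk {φ} lip {u} {v} (cons {w = w} {n = m} u~w walk) = begin
    φ v             ≤⟨ Lipschitz-walk lip walk ⟩
    φ w + m         ≤⟨ +-monoˡ-≤ m (lip u~w) ⟩
    suc (φ u) + m   ≡⟨ +-suc (φ u) m ⟨
    φ u + suc m     ∎
    where open ≤-Reasoning

  Lipschitz⇒DistAtLeast : ∀ {φ} → Lipschitz φ → ∀ {u v d} → φ u ≡ 0 → d ≤ φ v →
                          DistAtLeast G d u v
  Lipschitz⇒DistAtLeast {φ} lip {u} {v} φu≡0 d≤φv m m<d walk = <⇒≱ m<d (begin
    _         ≤⟨ d≤φv ⟩
    φ v       ≤⟨ Lipschitz-walk lip walk ⟩
    φ u + m   ≡⟨ cong (_+ m) φu≡0 ⟩
    m         ∎)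
    where open ≤-Reasoning

  PackingColorable-mono : ∀ {j k} → j ≤ k → PackingColorable G j → PackingColorable G k
  PackingColorable-mono {j} {k} j≤k (c , packing) = c′ , packing′
    where
    c′ : V G → Fin k
    c′ u = inject≤ (c u) j≤k
    packing′ : IsPackingColoring G k c′
    packing′ u v u≢v same rewrite toℕ-inject≤ (c u) j≤k =
      packing u v u≢v (inject≤-injective j≤k j≤k (c u) (c v) same)

  ℕ-colouring⇒PackingColorable : ∀ k (col : V G → ℕ) → (∀ u → 0 < col u × col u ≤ k) →
    (∀ u v → u ≢ v → col u ≡ col v → DistAtLeast G (suc (col u)) u v) →
    PackingColorable G k
  ℕ-colouring⇒PackingColorable k col range separated = c , packing
    where
    suc-pred-col : ∀ u → suc (col u ∸ 1) ≡ col u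
    suc-pred-col u = trans (+-comm 1 _) (m∸n+n≡m (proj₁ (range u)))
    c : V G → Fin k
    c u = fromℕ< (subst (_≤ k) (sym (suc-pred-col u)) (proj₂ (range u)))
    col≡ : ∀ u → suc (toℕ (c u)) ≡ col u
    col≡ u = trans (cong suc (toℕ-fromℕ< _)) (suc-pred-col u)
    packing : IsPackingColoring G k c
    packing u v u≢v same rewrite col≡ u =
      separated u v u≢v (trans (sym (col≡ u)) (trans (cong (suc ∘ toℕ) same) (col≡ v)))

-- Distance on a cycle

WithinOne : ℕ → ℕ → Set
WithinOne a b = a ≤ suc b × b ≤ suc a

WithinOne-sym : ∀ {a b} → WithinOne a b → WithinOne b a
WithinOne-sym (p , q) = q , p

WithinOne-suc : ∀ a → WithinOne a (suc a)
WithinOne-suc a = m≤n⇒m≤1+n (n≤1+n a) , ≤-refl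

WithinOne-≡suc : ∀ {a b} → b ≡ suc a → WithinOne a b
WithinOne-≡suc {a} refl = WithinOne-suc a

WithinOne-+ˡ : ∀ c {a b} → WithinOne a b → WithinOne (c + a) (c + b)
WithinOne-+ˡ c {a} {b} (p , q) =
  subst (c + a ≤_) (+-suc c b) (+-monoʳ-≤ c p) , subst (c + b ≤_) (+-suc c a) (+-monoʳ-≤ c q)

∣-∣-WithinOne : ∀ x y → WithinOne ∣ x - y ∣ ∣ x - suc y ∣
∣-∣-WithinOne zero    y       = WithinOne-suc y
∣-∣-WithinOne (suc x) zero    rewrite ∣-∣-identityʳ x = WithinOne-sym (WithinOne-suc x)
∣-∣-WithinOne (suc x) (suc y) = ∣-∣-WithinOne x y

∸-WithinOne : ∀ n {a b} → WithinOne a b → WithinOne (n ∸ a) (n ∸ b)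
∸-WithinOne n (p , q) = shift q , shift p
  where
  suc-∸ : ∀ m k → suc m ∸ k ≤ suc (m ∸ k)
  suc-∸ m       zero    = ≤-refl
  suc-∸ zero    (suc k) = subst (_≤ 1) (sym (0∸n≡0 k)) z≤n
  suc-∸ (suc m) (suc k) = suc-∸ m k
  shift : ∀ {a b} → a ≤ suc b → n ∸ b ≤ suc (n ∸ a)
  shift {a} a≤1+b = ≤-trans (∸-monoʳ-≤ (suc n) a≤1+b) (suc-∸ n a)

module CyclicDistance (n : ℕ) where

  arc : ℕ → ℕ
  arc D = D ⊓ (n ∸ D)

  cdist : ℕ → ℕ → ℕ
  cdist x y = arc ∣ x - y ∣

  arc-WithinOne : ∀ {D D′} → WithinOne D D′ → WithinOne (arc D) (arc D′)
  arc-WithinOne {D} {D′} w@(p , q) = shrink D D′ p (proj₁ (∸-WithinOne n w))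
                                   , shrink D′ D q (proj₂ (∸-WithinOne n w))
    where
    shrink : ∀ a b → a ≤ suc b → n ∸ a ≤ suc (n ∸ b) → arc a ≤ suc (arc b)
    shrink a b p q = ⊓-glb (≤-trans (m⊓n≤m a _) p) (≤-trans (m⊓n≤n a _) q)

  arc-n∸ : ∀ {D} → D ≤ n → arc (n ∸ D) ≡ arc D
  arc-n∸ {D} D≤n rewrite m∸[m∸n]≡n D≤n = ⊓-comm (n ∸ D) D

  cdist-sym : ∀ x y → cdist x y ≡ cdist y x
  cdist-sym x y = cong arc (∣-∣-comm x y)

  cdist-self : ∀ x → cdist x x ≡ 0
  cdist-self x rewrite ∣n-n∣≡0 x = refl

  cdist-suc : ∀ x y → WithinOne (cdist x y) (cdist x (suc y))
  cdist-suc x y = arc-WithinOne (∣-∣-WithinOne x y)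

  cdist-wrap : ∀ {x} → x < n → WithinOne (cdist x (n ∸ 1)) (cdist x 0)
  cdist-wrap {x} x<n rewrite ∣-∣-identityʳ x = subst (λ d → WithinOne d (arc x)) (sym around)
    (arc-WithinOne (WithinOne-sym (WithinOne-suc x)))
    where
    x≤n∸1 : x ≤ n ∸ 1
    x≤n∸1 = subst (x ≤_) (sym (pred[m∸n]≡m∸[1+n] n 0)) (<⇒≤pred x<n)
    around : cdist x (n ∸ 1) ≡ arc (suc x)
    around = begin
      arc ∣ x - n ∸ 1 ∣   ≡⟨ cong arc (m≤n⇒∣m-n∣≡n∸m x≤n∸1) ⟩
      arc (n ∸ 1 ∸ x)     ≡⟨ cong arc (∸-+-assoc n 1 x) ⟩
      arc (n ∸ suc x)     ≡⟨ arc-n∸ x<n ⟩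
      arc (suc x)         ∎
      where open ≡-Reasoning

  -- Going forward round the cycle, b comes at least K steps after a and a + n at least
  -- K steps after b.
  Separated : ℕ → ℕ → ℕ → Set
  Separated K a b = a + K ≤ b × b + K ≤ a + n

  cdist-≥ : ∀ {K x y} → Separated K x y → K ≤ cdist x y
  cdist-≥ {K} {x} (p , q) with d , refl ← m≤n⇒∃[o]m+o≡n (≤-trans (m≤m+n x K) p)
    rewrite m≤n⇒∣m-n∣≡n∸m (m≤m+n x d) | m+n∸m≡n x d =
    ⊓-glb (+-cancelˡ-≤ x K d p) (m+n≤o⇒m≤o∸n K (+-cancelˡ-≤ x (K + d) n (begin
      x + (K + d)  ≡⟨ cong (x +_) (+-comm K d) ⟩
      x + (d + K)  ≡⟨ +-assoc x d K ⟨
      x + d + K    ≤⟨ q ⟩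
      x + n        ∎)))
    where open ≤-Reasoning

  cdist-≥′ : ∀ {K x y} → Separated K x y ⊎ Separated K y x → K ≤ cdist x y
  cdist-≥′ (inj₁ sep) = cdist-≥ sep
  cdist-≥′ {K} {x} {y} (inj₂ sep) = subst (K ≤_) (cdist-sym y x) (cdist-≥ sep)

  Separated-+⁻ : ∀ c {K a b} → Separated K (a + c) (b + c) → Separated K a b
  Separated-+⁻ c {K} {a} {b} (p , q) =
    +-cancelʳ-≤ c (a + K) b (subst (_≤ b + c) (+-swap a c K) p) ,
    +-cancelʳ-≤ c (b + K) (a + n) (subst₂ _≤_ (+-swap b c K) (+-swap a c n) q)
    where +-swap : ∀ a c K → a + c + K ≡ a + K + c
          +-swap = solve-∀

  Separated-rotate⁻ : ∀ {K a b} → Separated K a (b + n) → Separated K b a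
  Separated-rotate⁻ {K} {a} {b} (p , q) =
    +-cancelʳ-≤ n (b + K) a (subst (_≤ a + n) (+-swap b n K) q) , p
    where +-swap : ∀ a n K → a + n + K ≡ a + K + n
          +-swap = solve-∀

  Separated-1 : ∀ {a b} → a < b → b < n → Separated 1 a b
  Separated-1 {a} {b} a<b b<n =
    subst (_≤ b) (+-comm 1 a) a<b , subst (_≤ a + n) (+-comm 1 b) (≤-trans b<n (m≤n+m n a))

  cdist-pos : ∀ {x y} → x < n → y < n → x ≢ y → 1 ≤ cdist x y
  cdist-pos {x} {y} x<n y<n x≢y with <-cmp x y
  ... | tri< x<y _ _ = cdist-≥′ (inj₁ (Separated-1 x<y y<n))
  ... | tri≈ _ x≡y _ = ⊥-elim (x≢y x≡y)
  ... | tri> _ _ y<x = cdist-≥′ (inj₂ (Separated-1 y<x x<n))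

  CyclePacking : (ℕ → ℕ) → Set
  CyclePacking R = ∀ {x y} → x < n → y < n → x ≢ y → R x ≡ R y → suc (R x) ≤ cdist x y

-- Routes in the path-aligned product P_{qℓ} ◇_ℓ C_n, where ℓ = suc p

module Routes (q p n : ℕ) (p<n : p < n) (p+p≤n : p + p ≤ n) where
  open CyclicDistance n

  ℓ : ℕ
  ℓ = suc p

  -- From (i , x) to (j , y), i < j: round copy i to its path vertex p, then the link
  -- edge, then j - i - 1 whole copies of ℓ steps each, then from 0 round copy j to y.
  route : ℕ → ℕ → ℕ → ℕ → ℕ
  route zero    zero    x y = cdist x y
  route zero    (suc j) x y = cdist x p + suc (j * ℓ + cdist 0 y)
  route (suc i) zero    x y = cdist x 0 + suc (i * ℓ + cdist p y)
  route (suc i) (suc j) x y = route i j x y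

  route-self : ∀ i x → route i i x x ≡ 0
  route-self zero    x = cdist-self x
  route-self (suc i) x = route-self i x

  route-sym : ∀ i j x y → route i j x y ≡ route j i y x
  route-sym zero    zero    x y = cdist-sym x y
  route-sym zero    (suc j) x y rewrite cdist-sym x p | cdist-sym 0 y =
    shuffle (cdist p x) (j * ℓ) (cdist y 0)
    where shuffle : ∀ a m b → a + suc (m + b) ≡ b + suc (m + a)
          shuffle = solve-∀
  route-sym (suc i) zero    x y = sym (route-sym zero (suc i) y x)
  route-sym (suc i) (suc j) x y = route-sym i j x y

  CycleStep : ℕ → ℕ → Set
  CycleStep y y′ = y′ ≡ suc y ⊎ (y ≡ n ∸ 1 × y′ ≡ 0)

  cdist-step : ∀ {x y y′} → x < n → CycleStep y y′ → WithinOne (cdist x y) (cdist x y′)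
  cdist-step {x} {y} _   (inj₁ refl)          = cdist-suc x y
  cdist-step         x<n (inj₂ (refl , refl)) = cdist-wrap x<n

  route-step : ∀ i j {x y y′} → x < n → CycleStep y y′ → WithinOne (route i j x y) (route i j x y′)
  route-step zero    zero    x<n step = cdist-step x<n step
  route-step zero    (suc j) {x} x<n step =
    WithinOne-+ˡ (cdist x p) (WithinOne-+ˡ 1 (WithinOne-+ˡ (j * ℓ) (cdist-step (≤-<-trans z≤n p<n) step)))
  route-step (suc i) zero    {x} x<n step =
    WithinOne-+ˡ (cdist x 0) (WithinOne-+ˡ 1 (WithinOne-+ˡ (i * ℓ) (cdist-step p<n step)))
  route-step (suc i) (suc j) x<n step = route-step i j x<n step

  cdist-0-p : cdist 0 p ≡ p
  cdist-0-p = m≤n⇒m⊓n≡m (m+n≤o⇒m≤o∸n p p+p≤n)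

  one-more-copy : ∀ j → suc j * ℓ + 0 ≡ suc (j * ℓ + p)
  one-more-copy j = rearrange j p
    where rearrange : ∀ j p → suc j * suc p + 0 ≡ suc (j * suc p + p)
          rearrange = solve-∀

  route-link : ∀ i j x → WithinOne (route i j x p) (route i (suc j) x 0)
  route-link zero          zero    x = WithinOne-≡suc (+-comm (cdist x p) 1)
  route-link zero          (suc j) x rewrite cdist-0-p =
    WithinOne-+ˡ (cdist x p) (WithinOne-+ˡ 1 (WithinOne-≡suc (one-more-copy j)))
  route-link (suc zero)    zero    x rewrite cdist-self p = WithinOne-sym (WithinOne-≡suc (+-comm (cdist x 0) 1))
  route-link (suc (suc i)) zero    x rewrite cdist-self p | cdist-sym p 0 | cdist-0-p =
    WithinOne-sym (WithinOne-+ˡ (cdist x 0) (WithinOne-+ˡ 1 (WithinOne-≡suc (one-more-copy i))))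
  route-link (suc i)       (suc j) x = route-link i j x

  route-from : Fin q × Fin n → Fin q × Fin n → ℕ
  route-from (i , x) (j , y) = route (toℕ i) (toℕ j) (toℕ x) (toℕ y)

  route-arc : ∀ u {v w} → PCArc q ℓ n v w → WithinOne (route-from u v) (route-from u w)
  route-arc (i , x) (cyc j a b step) = route-step (toℕ i) (toℕ j) (toℕ<n x) step
  route-arc (i , x) (link j j′ a b j′≡ a≡ b≡) rewrite j′≡ | a≡ | b≡ =
    route-link (toℕ i) (toℕ j) (toℕ x)

  route-Lipschitz : ∀ u → Lipschitz (PathCycleProduct q ℓ n) (route-from u)
  route-Lipschitz u (inj₁ arc) = proj₂ (route-arc u arc)
  route-Lipschitz u (inj₂ arc) = proj₁ (route-arc u arc)

  RouteSeparated : (ℕ → ℕ → ℕ) → Set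
  RouteSeparated col = ∀ {i j x y} → i < q → j < q → x < n → y < n → (i ≡ j → x ≢ y) →
                       col i x ≡ col j y → suc (col i x) ≤ route i j x y

  RouteSeparated-from-≤ : ∀ col →
    (∀ {i j x y} → i ≤ j → i < q → j < q → x < n → y < n → (i ≡ j → x ≢ y) →
       col i x ≡ col j y → suc (col i x) ≤ route i j x y) →
    RouteSeparated col
  RouteSeparated-from-≤ col ordered {i} {j} {x} {y} i<q j<q x<n y<n distinct same with ≤-total i j
  ... | inj₁ i≤j = ordered i≤j i<q j<q x<n y<n distinct same
  ... | inj₂ j≤i = subst₂ (λ k d → suc k ≤ d) (sym same) (route-sym j i y x)
                     (ordered j≤i j<q i<q y<n x<n (λ j≡i y≡x → distinct (sym j≡i) (sym y≡x)) (sym same))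

  RouteSeparated⇒PackingColorable : ∀ k col → (∀ i x → 0 < col i x × col i x ≤ k) →
                                    RouteSeparated col → PackingColorable (PathCycleProduct q ℓ n) k
  RouteSeparated⇒PackingColorable k col range separated =
    ℕ-colouring⇒PackingColorable _ k (λ (i , x) → col (toℕ i) (toℕ x))
      (λ (i , x) → range (toℕ i) (toℕ x))
      λ (i , x) (j , y) u≢v same →
        Lipschitz⇒DistAtLeast _ (route-Lipschitz (i , x)) (route-self (toℕ i) (toℕ x))
          (separated (toℕ<n i) (toℕ<n j) (toℕ<n x) (toℕ<n y)
            (λ i≡j x≡y → u≢v (cong₂ _,_ (toℕ-injective i≡j) (toℕ-injective x≡y))) same)

-- Rotations of the word κ 1 2 1 3 … 1 2 1 3 1 colour C_{4s+2}

motif : ℕ → ℕ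
motif 0 = 1
motif 1 = 2
motif 2 = 1
motif 3 = 3
motif (suc (suc (suc (suc k)))) = motif k

motif-cases : ∀ k → motif k ≡ 1 ⊎ motif k ≡ 2 ⊎ motif k ≡ 3
motif-cases 0 = inj₁ refl
motif-cases 1 = inj₂ (inj₁ refl)
motif-cases 2 = inj₁ refl
motif-cases 3 = inj₂ (inj₂ refl)
motif-cases (suc (suc (suc (suc k)))) = motif-cases k

motif-range : ∀ k → 0 < motif k × motif k ≤ 3
motif-range 0 = z<s , from-yes (1 ≤? 3)
motif-range 1 = z<s , from-yes (2 ≤? 3)
motif-range 2 = z<s , from-yes (1 ≤? 3)
motif-range 3 = z<s , from-yes (3 ≤? 3)
motif-range (suc (suc (suc (suc k)))) = motif-range k

motif-small : ∀ k {K} → 4 ≤ K → motif k ≢ K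
motif-small k 4≤K refl = <⇒≱ (s≤s (proj₂ (motif-range k))) 4≤K

motif-periodic : ∀ m k → motif (m * 4 + k) ≡ motif k
motif-periodic zero    k = refl
motif-periodic (suc m) k = motif-periodic m k

motif-+4* : ∀ k m → motif (k + 4 * m) ≡ motif k
motif-+4* k m = trans (cong motif (rearrange k m)) (motif-periodic m k)
  where rearrange : ∀ k m → k + 4 * m ≡ m * 4 + k
        rearrange = solve-∀

motif-spaced : ∀ k d → 0 < d → motif k ≡ motif (k + d) → suc (motif k) ≤ d
motif-spaced k 0 () _
motif-spaced k (suc (suc (suc (suc d)))) _ _ = ≤-trans (s≤s (proj₂ (motif-range k))) (m≤m+n 4 d)
motif-spaced (suc (suc (suc (suc k)))) d 0<d same = motif-spaced k d 0<d same
motif-spaced 0 2 _ _  = ≤-refl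
motif-spaced 2 2 _ _  = ≤-refl
motif-spaced 0 1 _ ()
motif-spaced 0 3 _ ()
motif-spaced 1 1 _ ()
motif-spaced 1 2 _ ()
motif-spaced 1 3 _ ()
motif-spaced 2 1 _ ()
motif-spaced 2 3 _ ()
motif-spaced 3 1 _ ()
motif-spaced 3 2 _ ()
motif-spaced 3 3 _ ()

-- κ at the pivot p, then motif from index p + 1 + c onwards round the cycle. Positions
-- x < p stand for x + n, and motif (x + n) = motif (x + 2) when n ≡ 2 (mod 4).
row : (p c κ : ℕ) → ℕ → ℕ
row p c κ x with <-cmp x p
... | tri< _ _ _ = motif (x + c + 2)
... | tri≈ _ _ _ = κ
... | tri> _ _ _ = motif (x + c)

module _ {p c κ : ℕ} where

  row-pivot : row p c κ p ≡ κ
  row-pivot with <-cmp p p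
  ... | tri< p<p _ _ = ⊥-elim (<-irrefl refl p<p)
  ... | tri≈ _ _ _   = refl
  ... | tri> _ _ p<p = ⊥-elim (<-irrefl refl p<p)

  row-above : ∀ {x} → p < x → row p c κ x ≡ motif (x + c)
  row-above {x} p<x with <-cmp x p
  ... | tri< x<p _ _ = ⊥-elim (<-asym x<p p<x)
  ... | tri≈ _ x≡p _ = ⊥-elim (<-irrefl (sym x≡p) p<x)
  ... | tri> _ _ _   = refl

  row-below : ∀ {x} → x < p → row p c κ x ≡ motif (x + c + 2)
  row-below {x} x<p with <-cmp x p
  ... | tri< _ _ _   = refl
  ... | tri≈ _ x≡p _ = ⊥-elim (<-irrefl x≡p x<p)
  ... | tri> _ _ p<x = ⊥-elim (<-asym x<p p<x)

  row-cases : ∀ x → row p c κ x ≡ κ ⊎ row p c κ x ≡ 1 ⊎ row p c κ x ≡ 2 ⊎ row p c κ x ≡ 3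
  row-cases x with <-cmp x p
  ... | tri< _ _ _ = inj₂ (motif-cases (x + c + 2))
  ... | tri≈ _ _ _ = inj₁ refl
  ... | tri> _ _ _ = inj₂ (motif-cases (x + c))

  row-values : ∀ x → row p c κ x ≡ κ ⊎ (0 < row p c κ x × row p c κ x ≤ 3)
  row-values x with <-cmp x p
  ... | tri< _ _ _ = inj₂ (motif-range (x + c + 2))
  ... | tri≈ _ _ _ = inj₁ refl
  ... | tri> _ _ _ = inj₂ (motif-range (x + c))

  row-range : ∀ {k} → 3 ≤ κ → κ ≤ k → ∀ x → 0 < row p c κ x × row p c κ x ≤ k
  row-range {k} 3≤κ κ≤k x with row-values x
  ... | inj₁ Rx≡κ           = subst (λ r → 0 < r × r ≤ k) (sym Rx≡κ) (≤-trans (s≤s z≤n) 3≤κ , κ≤k)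
  ... | inj₂ (0<Rx , Rx≤3) = 0<Rx , ≤-trans Rx≤3 (≤-trans 3≤κ κ≤k)

  row≡κ⇒pivot : 4 ≤ κ → ∀ {x} → row p c κ x ≡ κ → x ≡ p
  row≡κ⇒pivot 4≤κ {x} Rx≡κ with <-cmp x p
  ... | tri< _ _ _   = ⊥-elim (motif-small (x + c + 2) 4≤κ Rx≡κ)
  ... | tri≈ _ x≡p _ = x≡p
  ... | tri> _ _ _   = ⊥-elim (motif-small (x + c) 4≤κ Rx≡κ)

module CycleColouring (s : ℕ) where

  n : ℕ
  n = 4 * s + 2

  open CyclicDistance n public

  motif-+n : ∀ k → motif (k + n) ≡ motif (k + 2)
  motif-+n k = trans (cong motif (rearrange k s)) (motif-+4* (k + 2) s)
    where rearrange : ∀ k s → k + (4 * s + 2) ≡ k + 2 + 4 * s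
          rearrange = solve-∀

  -- The letters at indices E, …, E + 4s, closed up into a cycle of length n by one more
  -- vertex.
  motif-separated : ∀ {E a b} → motif E ≡ 1 → E ≤ a → a < b → b ≤ E + 4 * s → motif a ≡ motif b →
                    Separated (suc (motif a)) a b
  motif-separated {E} {a} {b} mE≡1 E≤a a<b b≤E+4s same = forward , backward
    where
    open ≤-Reasoning
    forward : a + suc (motif a) ≤ b
    forward = begin
      a + suc (motif a)  ≤⟨ +-monoʳ-≤ a (motif-spaced a (b ∸ a) (m<n⇒0<n∸m a<b)
                                          (trans same (cong motif (sym (m+[n∸m]≡n (<⇒≤ a<b)))))) ⟩
      a + (b ∸ a)        ≡⟨ m+[n∸m]≡n (<⇒≤ a<b) ⟩
      b                  ∎
    backward : b + suc (motif a) ≤ a + n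
    backward with motif a ≟ 1
    ... | yes ma≡1 rewrite ma≡1 = begin
      b + 2              ≤⟨ +-monoˡ-≤ 2 b≤E+4s ⟩
      E + 4 * s + 2      ≤⟨ +-monoˡ-≤ 2 (+-monoˡ-≤ (4 * s) E≤a) ⟩
      a + 4 * s + 2      ≡⟨ +-assoc a (4 * s) 2 ⟩
      a + n              ∎
    ... | no ma≢1 = begin
      b + suc (motif a)  ≤⟨ +-monoʳ-≤ b (s≤s (proj₂ (motif-range a))) ⟩
      b + 4              ≡⟨ +-suc b 3 ⟩
      suc b + 3          ≤⟨ +-monoˡ-≤ 3 b<E+4s ⟩
      E + 4 * s + 3      ≡⟨ rearrange E (4 * s) ⟩
      suc E + n          ≤⟨ +-monoˡ-≤ n E<a ⟩
      a + n              ∎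
      where
      rearrange : ∀ E m → E + m + 3 ≡ suc E + (m + 2)
      rearrange = solve-∀
      E<a : E < a
      E<a = ≤∧≢⇒< E≤a λ E≡a → ma≢1 (trans (cong motif (sym E≡a)) mE≡1)
      b<E+4s : b < E + 4 * s
      b<E+4s = ≤∧≢⇒< b≤E+4s λ b≡E+4s →
        ma≢1 (trans same (trans (cong motif b≡E+4s) (trans (motif-+4* E s) mE≡1)))

  -- The position of x on the cycle cut open at the pivot p; the value at p is junk.
  unroll : ℕ → ℕ → ℕ
  unroll p x with <-cmp x p
  ... | tri< _ _ _ = x + n
  ... | _          = x

  module _ {p x : ℕ} (x<n : x < n) (x≢p : x ≢ p) where

    row-unroll : ∀ {c κ} → row p c κ x ≡ motif (unroll p x + c)
    row-unroll {c} with <-cmp x p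
    ... | tri< _ _ _   = trans (sym (motif-+n (x + c))) (cong motif (+-swap x c n))
      where +-swap : ∀ x c n → x + c + n ≡ x + n + c
            +-swap = solve-∀
    ... | tri≈ _ x≡p _ = ⊥-elim (x≢p x≡p)
    ... | tri> _ _ _   = refl

    unroll-range : p < n → suc p ≤ unroll p x × unroll p x < p + n
    unroll-range p<n with <-cmp x p
    ... | tri< x<p _ _ = ≤-trans p<n (m≤n+m n x) , +-monoˡ-< n x<p
    ... | tri≈ _ x≡p _ = ⊥-elim (x≢p x≡p)
    ... | tri> _ _ p<x = p<x , ≤-trans x<n (m≤n+m n p)

  module _ {p x y : ℕ} (x<n : x < n) (y<n : y < n) (x≢p : x ≢ p) (y≢p : y ≢ p) where

    unroll-injective : x ≢ y → unroll p x ≢ unroll p y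
    unroll-injective x≢y with <-cmp x p | <-cmp y p
    ... | tri≈ _ x≡p _ | _            = ⊥-elim (x≢p x≡p)
    ... | _            | tri≈ _ y≡p _ = ⊥-elim (y≢p y≡p)
    ... | tri< _ _ _   | tri< _ _ _   = x≢y ∘ +-cancelʳ-≡ n x y
    ... | tri< _ _ _   | tri> _ _ _   = λ e → <⇒≢ (≤-trans y<n (m≤n+m n x)) (sym e)
    ... | tri> _ _ _   | tri< _ _ _   = λ e → <⇒≢ (≤-trans x<n (m≤n+m n y)) e
    ... | tri> _ _ _   | tri> _ _ _   = x≢y

    Separated-unroll : ∀ {K} → Separated K (unroll p x) (unroll p y) → Separated K x y ⊎ Separated K y x
    Separated-unroll {K} sep with <-cmp x p | <-cmp y p
    ... | tri≈ _ x≡p _ | _            = ⊥-elim (x≢p x≡p)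
    ... | _            | tri≈ _ y≡p _ = ⊥-elim (y≢p y≡p)
    ... | tri< _ _ _   | tri< _ _ _   = inj₁ (Separated-+⁻ n sep)
    ... | tri< _ _ _   | tri> _ _ _   =
      ⊥-elim (<⇒≱ y<n (≤-trans (m≤n+m n x) (≤-trans (m≤m+n (x + n) K) (proj₁ sep))))
    ... | tri> _ _ _   | tri< _ _ _   = inj₂ (Separated-rotate⁻ sep)
    ... | tri> _ _ _   | tri> _ _ _   = inj₁ sep

  module _ {p c κ : ℕ} (p<n : p < n) (motif-after-pivot : motif (suc p + c) ≡ 1) (4≤κ : 4 ≤ κ) where

    private
      index-bound : ∀ {u} → u < p + n → u + c ≤ suc p + c + 4 * s
      index-bound {u} u<p+n = ≤-trans (+-monoˡ-≤ c (≤-pred (subst (suc u ≤_) (eq₁ p s) u<p+n)))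
                                      (≤-reflexive (eq₂ p c s))
        where eq₁ : ∀ p s → p + (4 * s + 2) ≡ suc (suc (p + 4 * s))
              eq₁ = solve-∀
              eq₂ : ∀ p c s → suc (p + 4 * s) + c ≡ suc p + c + 4 * s
              eq₂ = solve-∀

      separated : ∀ {x y} → x < n → y < n → x ≢ p → y ≢ p → unroll p x < unroll p y →
                  row p c κ x ≡ row p c κ y →
                  Separated (suc (row p c κ x)) x y ⊎ Separated (suc (row p c κ x)) y x
      separated {x} {y} x<n y<n x≢p y≢p ux<uy same rewrite row-unroll x<n x≢p {c} {κ} =
        Separated-unroll x<n y<n x≢p y≢p (Separated-+⁻ c (motif-separated motif-after-pivot
          (+-monoˡ-≤ c (proj₁ (unroll-range x<n x≢p p<n))) (+-monoˡ-< c ux<uy)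
          (index-bound (proj₂ (unroll-range y<n y≢p p<n))) (trans same (row-unroll y<n y≢p))))

      off-pivot : ∀ {x y} → x ≢ y → row p c κ x ≡ row p c κ y → x ≢ p
      off-pivot x≢y same refl = x≢y (sym (row≡κ⇒pivot 4≤κ (trans (sym same) (row-pivot {p} {c}))))

    row-packing : CyclePacking (row p c κ)
    row-packing x<n y<n x≢y same =
      by-unrolled-order x<n y<n x≢y (off-pivot x≢y same) (off-pivot (x≢y ∘ sym) (sym same)) same
      where
      by-unrolled-order : ∀ {x y} → x < n → y < n → x ≢ y → x ≢ p → y ≢ p →
                          row p c κ x ≡ row p c κ y → suc (row p c κ x) ≤ cdist x y
      by-unrolled-order {x} {y} x<n y<n x≢y x≢p y≢p same with <-cmp (unroll p x) (unroll p y)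
      ... | tri< ux<uy _ _ = cdist-≥′ (separated x<n y<n x≢p y≢p ux<uy same)
      ... | tri≈ _ ux≡uy _ = ⊥-elim (unroll-injective x<n y<n x≢p y≢p x≢y ux≡uy)
      ... | tri> _ _ uy<ux rewrite same = cdist-≥′ (swap (separated y<n x<n y≢p x≢p uy<ux (sym same)))

-- Upper bounds: four colours for at most three copies, five colours in general

module UpperBound (s : ℕ) (2≤s : 2 ≤ s) where
  open CycleColouring s

  10≤n : 10 ≤ n
  10≤n = +-monoˡ-≤ 2 (*-monoʳ-≤ 4 2≤s)

  small<n : ∀ k {k<10 : True (k <? 10)} → k < n
  small<n k {k<10} = <-≤-trans (toWitness k<10) 10≤n

  small<n∸1 : ∀ k {k<9 : True (k <? 9)} → k < n ∸ 1
  small<n∸1 k {k<9} = <-≤-trans (toWitness k<9) (∸-monoˡ-≤ 1 10≤n)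

  n∸1<n : n ∸ 1 < n
  n∸1<n = ∸-monoʳ-< (s≤s z≤n) (small<n 0)

  suc[n∸1]≡n : suc (n ∸ 1) ≡ n
  suc[n∸1]≡n = trans (+-comm 1 _) (m∸n+n≡m (small<n 0))

  far-from-0 : ∀ {m y} → m ≤ y → m + y ≤ n → m ≤ cdist 0 y
  far-from-0 {m} {y} m≤y m+y≤n = cdist-≥ (m≤y , subst (_≤ n) (+-comm m y) m+y≤n)

  far-from-2 : ∀ {m x} → 2 + m ≤ x → m + x ≤ 2 + n → m ≤ cdist x 2
  far-from-2 {m} {x} 2+m≤x m+x≤2+n =
    subst (m ≤_) (cdist-sym 2 x) (cdist-≥ (2+m≤x , subst (_≤ 2 + n) (+-comm m x) m+x≤2+n))

  record Avoids (R : ℕ → ℕ) (q K m : ℕ) : Set where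
    constructor avoiding
    field far : ∀ {x} → x < n → R x ≡ K → m ≤ cdist x q
  open Avoids

  anywhere : ∀ {R q K} → Avoids R q K 0
  anywhere = avoiding λ _ _ → z≤n

  module _ {R : ℕ → ℕ} {K : ℕ} where

    private
      apart : ∀ {x z} → R x ≡ K → R z ≢ K → x ≢ z
      apart Rx≡K Rz≢K refl = Rz≢K Rx≡K

    avoids-1 : ∀ {q} → q < n → R q ≢ K → Avoids R q K 1
    avoids-1 q<n Rq≢K = avoiding λ x<n Rx≡K → cdist-pos x<n q<n (apart Rx≡K Rq≢K)

    avoids-0-2 : R 0 ≢ K → R 1 ≢ K → R (n ∸ 1) ≢ K → Avoids R 0 K 2
    avoids-0-2 R0 R1 R-1 = avoiding ball
      where
      ball : ∀ {x} → x < n → R x ≡ K → 2 ≤ cdist x 0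
      ball {0}           _   Rx≡K = ⊥-elim (R0 Rx≡K)
      ball {1}           _   Rx≡K = ⊥-elim (R1 Rx≡K)
      ball {suc (suc x)} x<n Rx≡K =
        far-from-0 (s≤s (s≤s z≤n)) (≤∧≢⇒< x<n (apart Rx≡K R-1 ∘ cong (_∸ 1)))

    avoids-0-3 : R 0 ≢ K → R 1 ≢ K → R 2 ≢ K → R (n ∸ 1) ≢ K → R (n ∸ 2) ≢ K → Avoids R 0 K 3
    avoids-0-3 R0 R1 R2 R-1 R-2 = avoiding ball
      where
      ball : ∀ {x} → x < n → R x ≡ K → 3 ≤ cdist x 0
      ball {0}                 _   Rx≡K = ⊥-elim (R0 Rx≡K)
      ball {1}                 _   Rx≡K = ⊥-elim (R1 Rx≡K)
      ball {2}                 _   Rx≡K = ⊥-elim (R2 Rx≡K)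
      ball {suc (suc (suc x))} x<n Rx≡K =
        far-from-0 (s≤s (s≤s (s≤s z≤n)))
          (≤∧≢⇒< (≤∧≢⇒< x<n (apart Rx≡K R-1 ∘ cong (_∸ 1))) (apart Rx≡K R-2 ∘ cong (_∸ 2)))

    avoids-2-2 : R 1 ≢ K → R 2 ≢ K → R 3 ≢ K → Avoids R 2 K 2
    avoids-2-2 R1 R2 R3 = avoiding ball
      where
      ball : ∀ {x} → x < n → R x ≡ K → 2 ≤ cdist x 2
      ball {0} _ _    = cdist-≥ {x = 0} (≤-refl , small<n 3)
      ball {1} _ Rx≡K = ⊥-elim (R1 Rx≡K)
      ball {2} _ Rx≡K = ⊥-elim (R2 Rx≡K)
      ball {3} _ Rx≡K = ⊥-elim (R3 Rx≡K)
      ball {suc (suc (suc (suc x)))} x<n _ =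
        far-from-2 (s≤s (s≤s (s≤s (s≤s z≤n)))) (+-monoʳ-≤ 2 (<⇒≤ x<n))

    avoids-2-3 : R 0 ≢ K → R 1 ≢ K → R 2 ≢ K → R 3 ≢ K → R 4 ≢ K → Avoids R 2 K 3
    avoids-2-3 R0 R1 R2 R3 R4 = avoiding ball
      where
      ball : ∀ {x} → x < n → R x ≡ K → 3 ≤ cdist x 2
      ball {0} _ Rx≡K = ⊥-elim (R0 Rx≡K)
      ball {1} _ Rx≡K = ⊥-elim (R1 Rx≡K)
      ball {2} _ Rx≡K = ⊥-elim (R2 Rx≡K)
      ball {3} _ Rx≡K = ⊥-elim (R3 Rx≡K)
      ball {4} _ Rx≡K = ⊥-elim (R4 Rx≡K)
      ball {suc (suc (suc (suc (suc x))))} x<n _ =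
        far-from-2 (s≤s (s≤s (s≤s (s≤s (s≤s z≤n))))) (s≤s (s≤s x<n))

  avoids-pivot : ∀ {p c κ q m} → 4 ≤ κ → m ≤ cdist p q → Avoids (row p c κ) q κ m
  avoids-pivot {p} {c} {κ} {q} {m} 4≤κ m≤d = avoiding λ {x} _ Rx≡κ →
    subst (λ x → m ≤ cdist x q) (sym (row≡κ⇒pivot {p} {c} {κ} 4≤κ {x} Rx≡κ)) m≤d

  avoids-absent : ∀ {p c κ q m K} → 4 ≤ K → K ≢ κ → Avoids (row p c κ) q K m
  avoids-absent {p} {c} {κ} {K = K} 4≤K K≢κ = avoiding λ {x} _ Rx≡K → ⊥-elim (absent x Rx≡K)
    where
    absent : ∀ x → row p c κ x ≢ K
    absent x Rx≡K with row-values {p} {c} {κ} x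
    ... | inj₁ Rx≡κ         = K≢κ (trans (sym Rx≡K) Rx≡κ)
    ... | inj₂ (_ , Rx≤3)   = <⇒≱ (s≤s Rx≤3) (subst (4 ≤_) (sym Rx≡K) 4≤K)

  ≢-via : ∀ {a b K : ℕ} → a ≡ b → b ≢ K → a ≢ K
  ≢-via refl b≢K = b≢K


  row-last : ∀ {p κ} → p < n ∸ 1 → row p 1 κ (n ∸ 1) ≡ 1
  row-last p<n∸1 = trans (row-above p<n∸1) (trans (cong motif (trans (+-comm _ 1) suc[n∸1]≡n)) (motif-+n 0))

  -- Read from position 0 round the cycle:
  --   C₀ = 1 4 1 2 1 3 1 2 … 1 3,   C₁ = 3 1 2 1 3 1 4 1 2 … 1 2 1,   C₂ = 4 1 3 1 2 … 1 2 1,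
  --   A  = 1 2 1 3 … 1 2 1 3 1 4,   B  = 5 1 3 1 2 … 1 2 1.
  C₀ C₁ C₂ A B : ℕ → ℕ
  C₀ = row 1 2 4
  C₁ = row 6 1 4
  C₂ = row 0 1 4
  A  = row (n ∸ 1) 2 4
  B  = row 0 1 5

  A-below : ∀ x {x<9 : True (x <? 9)} → A x ≡ motif (x + 2 + 2)
  A-below x {x<9} = row-below (small<n∸1 x {x<9})

  motif-n+2 : motif (n + 2) ≡ 1
  motif-n+2 = trans (cong motif (+-comm n 2)) (motif-+n 2)

  A-second-last : A (n ∸ 2) ≡ 1
  A-second-last = begin
    A (n ∸ 2)               ≡⟨ row-below (∸-monoʳ-< ≤-refl 2≤n) ⟩
    motif (n ∸ 2 + 2 + 2)   ≡⟨ cong (λ k → motif (k + 2)) (m∸n+n≡m 2≤n) ⟩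
    motif (n + 2)           ≡⟨ motif-n+2 ⟩
    1                       ∎
    where
    open ≡-Reasoning
    2≤n : 2 ≤ n
    2≤n = <⇒≤ (small<n 2)

  row₀-avoids-0 : ∀ {κ K} → κ ≢ K → 1 ≢ K → Avoids (row 0 1 κ) 0 K 2
  row₀-avoids-0 κ≢K 1≢K = avoids-0-2 κ≢K 1≢K (≢-via (row-last (small<n∸1 0)) 1≢K)

  -- Same colour in copies i and i + 1 (route length cdist x 2 + 1 + cdist 0 y) and in
  -- copies i and i + 2 (route length cdist x 2 + 4 + cdist 0 y).
  Consecutive SecondNext : (ℕ → ℕ) → (ℕ → ℕ) → Set
  Consecutive R R′ = ∀ {x y} → x < n → y < n → R x ≡ R′ y → R x ≤ cdist x 2 + cdist 0 y
  SecondNext  R R′ = ∀ {x y} → x < n → y < n → R x ≡ R′ y → R x ≤ cdist x 2 + (3 + cdist 0 y)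

  record Gap (R R′ : ℕ → ℕ) (K : ℕ) : Set where
    constructor gap
    field
      {a b}  : ℕ
      near-2 : Avoids R 2 K a
      near-0 : Avoids R′ 0 K b
      enough : K ≤ a + b

  Gap-bound : ∀ {R R′ K x y} → Gap R R′ K → x < n → y < n → R x ≡ R′ y → R′ y ≡ K →
              R x ≤ cdist x 2 + cdist 0 y
  Gap-bound {y = y} (gap avoid avoid′ K≤a+b) x<n y<n same R′y≡K = begin
    _                ≡⟨ trans same R′y≡K ⟩
    _                ≤⟨ K≤a+b ⟩
    _                ≤⟨ +-mono-≤ (far avoid x<n (trans same R′y≡K)) (far avoid′ y<n R′y≡K) ⟩
    _ + cdist y 0    ≡⟨ cong (_ +_) (cdist-sym y 0) ⟩
    _                ∎
    where open ≤-Reasoning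

  consecutive-by-colour : ∀ {R p c κ} → let R′ = row p c κ in
                          Gap R R′ κ → Gap R R′ 1 → Gap R R′ 2 → Gap R R′ 3 → Consecutive R R′
  consecutive-by-colour {p = p} {c} {κ} gκ g₁ g₂ g₃ {y = y} x<n y<n same
    with row-cases {p} {c} {κ} y
  ... | inj₁ e               = Gap-bound gκ x<n y<n same e
  ... | inj₂ (inj₁ e)        = Gap-bound g₁ x<n y<n same e
  ... | inj₂ (inj₂ (inj₁ e)) = Gap-bound g₂ x<n y<n same e
  ... | inj₂ (inj₂ (inj₂ e)) = Gap-bound g₃ x<n y<n same e

  C₀-C₁ : Consecutive C₀ C₁
  C₀-C₁ = consecutive-by-colour {C₀}
    (gap anywhere (avoids-pivot ≤-refl (far-from-0 (from-yes (4 ≤? 6)) 10≤n)) ≤-refl)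
    (gap anywhere (avoids-1 (small<n 0) λ ()) ≤-refl)
    (gap anywhere (avoids-0-2 (λ ()) (λ ()) (≢-via (row-last (small<n∸1 6)) λ ())) ≤-refl)
    (gap (avoids-2-3 (λ ()) (λ ()) (λ ()) (λ ()) (λ ())) anywhere ≤-refl)

  C₁-C₂ : Consecutive C₁ C₂
  C₁-C₂ = consecutive-by-colour {C₁}
    (gap (avoids-pivot ≤-refl (far-from-2 (from-yes (6 ≤? 6)) (≤-trans 10≤n (m≤n+m n 2)))) anywhere ≤-refl)
    (gap anywhere (avoids-1 (small<n 0) λ ()) ≤-refl)
    (gap anywhere (row₀-avoids-0 (λ ()) (λ ())) ≤-refl)
    (gap (avoids-1 (small<n 2) λ ()) (row₀-avoids-0 (λ ()) (λ ())) ≤-refl)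

  A-B : Consecutive A B
  A-B = consecutive-by-colour {A}
    (gap (avoids-absent (from-yes (4 ≤? 5)) λ ()) anywhere ≤-refl)
    (gap anywhere (avoids-1 (small<n 0) λ ()) ≤-refl)
    (gap anywhere (row₀-avoids-0 (λ ()) (λ ())) ≤-refl)
    (gap (avoids-1 (small<n 2) (≢-via (A-below 2) λ ())) (row₀-avoids-0 (λ ()) (λ ())) ≤-refl)

  B-A : Consecutive B A
  B-A = consecutive-by-colour {B}
    (gap (avoids-absent ≤-refl λ ()) anywhere ≤-refl)
    (gap (avoids-1 (small<n 2) λ ()) anywhere ≤-refl)
    (gap (avoids-2-2 (λ ()) (λ ()) (λ ())) anywhere ≤-refl)
    (gap anywhere (avoids-0-3 (≢-via (A-below 0) λ ())
                              (≢-via (A-below 1) λ ())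
                              (≢-via (A-below 2) λ ())
                              (≢-via (row-pivot {n ∸ 1} {2}) λ ())
                              (≢-via A-second-last λ ())) ≤-refl)

  second-next : ∀ {p c p′ c′ κ} → 4 ≤ κ → κ ≤ cdist p 2 + (3 + cdist 0 p′) →
                SecondNext (row p c κ) (row p′ c′ κ)
  second-next {p} {c} {p′} {c′} {κ} 4≤κ bound {x} {y} _ _ same with row-values {p} {c} {κ} x
  ... | inj₁ Rx≡κ rewrite Rx≡κ | row≡κ⇒pivot {p} {c} {κ} 4≤κ {x} Rx≡κ
                            | row≡κ⇒pivot {p′} {c′} {κ} 4≤κ {y} (sym same) = bound
  ... | inj₂ (_ , Rx≤3) = ≤-trans Rx≤3 (≤-trans (m≤m+n 3 (cdist 0 y)) (m≤n+m _ (cdist x 2)))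

  C-copies : ℕ → ℕ → ℕ
  C-copies 0 = C₀
  C-copies 1 = C₁
  C-copies _ = C₂

  AB-copies : ℕ → ℕ → ℕ
  AB-copies 0             = A
  AB-copies 1             = B
  AB-copies (suc (suc i)) = AB-copies i

  module _ (t : ℕ) where
    open Routes t 2 n (small<n 2) (<⇒≤ (small<n 4))

    route-shift : ∀ i d x y → route i (i + d) x y ≡ route 0 d x y
    route-shift zero    d x y = refl
    route-shift (suc i) d x y = route-shift i d x y

    suc-≤-+-suc : ∀ {K X Y} → K ≤ X + Y → suc K ≤ X + suc Y
    suc-≤-+-suc {K} {X} {Y} K≤X+Y = subst (suc K ≤_) (sym (+-suc X Y)) (s≤s K≤X+Y)

    copies-separated : ∀ col → (∀ i → CyclePacking (col i)) →
                       (∀ i → i + 1 < t → Consecutive (col i) (col (i + 1))) →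
                       (∀ i → i + 2 < t → SecondNext (col i) (col (i + 2))) →
                       (∀ i x → col i x ≤ 6) → RouteSeparated col
    copies-separated col cycle consecutive second bounded = RouteSeparated-from-≤ col ordered
      where
      ordered : ∀ {i j x y} → i ≤ j → i < t → j < t → x < n → y < n → (i ≡ j → x ≢ y) →
                col i x ≡ col j y → suc (col i x) ≤ route i j x y
      ordered {i} {x = x} {y} i≤j _ j<t x<n y<n distinct same with d , refl ← m≤n⇒∃[o]m+o≡n i≤j
        rewrite route-shift i d x y = by-gap d j<t distinct same
        where
        by-gap : ∀ d → i + d < t → (i ≡ i + d → x ≢ y) → col i x ≡ col (i + d) y →
                 suc (col i x) ≤ route 0 d x y
        by-gap 0 _ distinct same =
          cycle i x<n y<n (distinct (sym (+-identityʳ i))) (trans same (cong (λ k → col k y) (+-identityʳ i)))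
        by-gap 1 i+1<t _ same = suc-≤-+-suc (consecutive i i+1<t x<n y<n same)
        by-gap 2 i+2<t _ same = suc-≤-+-suc (second i i+2<t x<n y<n same)
        by-gap (suc (suc (suc d))) _ _ _ =
          ≤-trans (s≤s (bounded i x)) (≤-trans (m≤m+n 7 (d * 3 + cdist 0 y)) (m≤n+m _ (cdist x 2)))

    C-copies-packing : t ≤ 3 → PackingColorable (P3t◇C t n) 4
    C-copies-packing t≤3 = RouteSeparated⇒PackingColorable 4 C-copies range
      (copies-separated C-copies cycle consecutive second (λ i x → ≤-trans (proj₂ (range i x)) (from-yes (4 ≤? 6))))
      where
      range : ∀ i x → 0 < C-copies i x × C-copies i x ≤ 4
      range 0             = row-range (from-yes (3 ≤? 4)) ≤-refl
      range 1             = row-range (from-yes (3 ≤? 4)) ≤-refl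
      range (suc (suc _)) = row-range (from-yes (3 ≤? 4)) ≤-refl
      cycle : ∀ i → CyclePacking (C-copies i)
      cycle 0             = row-packing (small<n 1) refl ≤-refl
      cycle 1             = row-packing (small<n 6) refl ≤-refl
      cycle (suc (suc _)) = row-packing (small<n 0) refl ≤-refl
      beyond : ∀ {i} → 3 + i < t → ∀ {P : Set} → P
      beyond 3+i<t = ⊥-elim (<⇒≱ 3+i<t (≤-trans t≤3 (m≤m+n 3 _)))
      consecutive : ∀ i → i + 1 < t → Consecutive (C-copies i) (C-copies (i + 1))
      consecutive 0             _     = C₀-C₁
      consecutive 1             _     = C₁-C₂
      consecutive (suc (suc i)) i+3<t = beyond (subst (_< t) (+-comm (2 + i) 1) i+3<t)
      second : ∀ i → i + 2 < t → SecondNext (C-copies i) (C-copies (i + 2))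
      second 0       _     = second-next ≤-refl (+-monoˡ-≤ 3 (cdist-pos (small<n 1) (small<n 2) λ ()))
      second (suc i) i+3<t = beyond (subst (_< t) (+-comm (suc i) 2) i+3<t)

    AB-copies-packing : PackingColorable (P3t◇C t n) 5
    AB-copies-packing = RouteSeparated⇒PackingColorable 5 AB-copies range
      (copies-separated AB-copies cycle (λ i _ → consecutive i) (λ i _ → second i)
        (λ i x → ≤-trans (proj₂ (range i x)) (from-yes (5 ≤? 6))))
      where
      range : ∀ i x → 0 < AB-copies i x × AB-copies i x ≤ 5
      range 0             = row-range (from-yes (3 ≤? 4)) (from-yes (4 ≤? 5))
      range 1             = row-range (from-yes (3 ≤? 5)) ≤-refl
      range (suc (suc i)) = range i
      motif-after-last : motif (suc (n ∸ 1) + 2) ≡ 1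
      motif-after-last = trans (cong (λ k → motif (k + 2)) suc[n∸1]≡n) motif-n+2
      cycle : ∀ i → CyclePacking (AB-copies i)
      cycle 0             = row-packing n∸1<n motif-after-last ≤-refl
      cycle 1             = row-packing (small<n 0) refl (from-yes (4 ≤? 5))
      cycle (suc (suc i)) = cycle i
      consecutive : ∀ i → Consecutive (AB-copies i) (AB-copies (i + 1))
      consecutive 0             = A-B
      consecutive 1             = B-A
      consecutive (suc (suc i)) = consecutive i
      second : ∀ i → SecondNext (AB-copies i) (AB-copies (i + 2))
      second 0             = second-next ≤-refl
        (≤-trans (+-monoˡ-≤ 3 (cdist-pos n∸1<n (small<n 2) (<⇒≢ (small<n∸1 2) ∘ sym)))
                 (+-monoʳ-≤ _ (m≤m+n 3 _)))
      second 1             = second-next (from-yes (4 ≤? 5))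
        (+-monoˡ-≤ 3 (cdist-≥ {x = 0} (≤-refl , small<n 3)))
      second (suc (suc i)) = second i

-- Lower bound: no packing 3-colouring of C_{4s+2}

-- A colouring of the path on ℕ with colours toℕ (h i) + 1, read as in IsPackingColoring.
IsPathPacking : (ℕ → Fin 3) → Set
IsPathPacking h = ∀ i d → d ≤ toℕ (h i) → h i ≢ h (suc d + i)

toℕ-≢zero : ∀ {n} {a : Fin (suc n)} → a ≢ 0F → 1 ≤ toℕ a
toℕ-≢zero {a = 0F}      a≢0 = ⊥-elim (a≢0 refl)
toℕ-≢zero {a = Fin.suc _} _ = s≤s z≤n

other-nonzero : ∀ {a b c : Fin 3} → a ≢ 0F → b ≢ 0F → c ≢ 0F → a ≢ b → b ≢ c → a ≡ c
other-nonzero {0F}           a≢0 _   _   _   _   = ⊥-elim (a≢0 refl)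
other-nonzero {_}  {0F}      _   b≢0 _   _   _   = ⊥-elim (b≢0 refl)
other-nonzero {_}  {_}  {0F} _   _   c≢0 _   _   = ⊥-elim (c≢0 refl)
other-nonzero {1F} {1F}      _   _   _   a≢b _   = ⊥-elim (a≢b refl)
other-nonzero {2F} {2F}      _   _   _   a≢b _   = ⊥-elim (a≢b refl)
other-nonzero {1F} {2F} {1F} _   _   _   _   _   = refl
other-nonzero {1F} {2F} {2F} _   _   _   _   b≢c = ⊥-elim (b≢c refl)
other-nonzero {2F} {1F} {2F} _   _   _   _   _   = refl
other-nonzero {2F} {1F} {1F} _   _   _   _   b≢c = ⊥-elim (b≢c refl)

module _ {h : ℕ → Fin 3} (packing : IsPathPacking h) where

  private
    clash : ∀ i d {c} → h i ≡ c → h (suc d + i) ≡ c → d ≤ toℕ c → ⊥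
    clash i d refl e d≤c = packing i d d≤c (sym e)

    no-2-3 : ∀ k → h (2 + k) ≡ 1F → h (3 + k) ≡ 2F → ⊥
    no-2-3 k e₂ e₃ with h (1 + k) in e₁ | h k in e₀
    ... | 0F | 0F = clash k 0 e₀ e₁ z≤n
    ... | 0F | 1F = clash k 1 e₀ e₂ ≤-refl
    ... | 0F | 2F = clash k 2 e₀ e₃ ≤-refl
    ... | 1F | _  = clash (1 + k) 0 e₁ e₂ z≤n
    ... | 2F | _  = clash (1 + k) 1 e₁ e₃ (s≤s z≤n)

    no-3-2 : ∀ k → h (2 + k) ≡ 2F → h (3 + k) ≡ 1F → ⊥
    no-3-2 k e₂ e₃ with h (4 + k) in e₄ | h (5 + k) in e₅
    ... | 0F | 0F = clash (4 + k) 0 e₄ e₅ z≤n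
    ... | 0F | 1F = clash (3 + k) 1 e₃ e₅ ≤-refl
    ... | 0F | 2F = clash (2 + k) 2 e₂ e₅ ≤-refl
    ... | 1F | _  = clash (3 + k) 0 e₃ e₄ z≤n
    ... | 2F | _  = clash (2 + k) 1 e₂ e₄ (s≤s z≤n)

  ones-dense : ∀ k → h (2 + k) ≡ 0F ⊎ h (3 + k) ≡ 0F
  ones-dense k with h (2 + k) in e₂ | h (3 + k) in e₃
  ... | 0F | _  = inj₁ refl
  ... | _  | 0F = inj₂ refl
  ... | 1F | 1F = ⊥-elim (clash (2 + k) 0 e₂ e₃ z≤n)
  ... | 2F | 2F = ⊥-elim (clash (2 + k) 0 e₂ e₃ z≤n)
  ... | 1F | 2F = ⊥-elim (no-2-3 k e₂ e₃)
  ... | 2F | 1F = ⊥-elim (no-3-2 k e₂ e₃)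

  zero-step : ∀ k → h (2 + k) ≡ 0F → h (4 + k) ≡ 0F
  zero-step k e₂ with ones-dense (1 + k)
  ... | inj₁ e₃ = ⊥-elim (clash (2 + k) 0 e₂ e₃ z≤n)
  ... | inj₂ e₄ = e₄

  nonzero-step : ∀ k → h (2 + k) ≢ 0F → h (4 + k) ≢ 0F × h (4 + k) ≢ h (2 + k)
  nonzero-step k h₂≢0 with ones-dense k
  ... | inj₁ e₂ = ⊥-elim (h₂≢0 e₂)
  ... | inj₂ e₃ = (λ e₄ → clash (3 + k) 0 e₃ e₄ z≤n)
                , (λ e₄ → clash (2 + k) 1 refl e₄ (toℕ-≢zero h₂≢0))

  period-4 : ∀ k → h (6 + k) ≡ h (2 + k)
  period-4 k with h (2 + k) Fin.≟ 0F
  ... | yes e₂  = trans (zero-step (2 + k) (zero-step k e₂)) (sym e₂)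
  ... | no h₂≢0 =
    let (h₄≢0 , h₄≢h₂) = nonzero-step k h₂≢0
        (h₆≢0 , h₆≢h₄) = nonzero-step (2 + k) h₄≢0
    in sym (other-nonzero h₂≢0 h₄≢0 h₆≢0 (h₄≢h₂ ∘ sym) (h₆≢h₄ ∘ sym))

  period-4* : ∀ m k → h (2 + (m * 4 + k)) ≡ h (2 + k)
  period-4* zero    k = refl
  period-4* (suc m) k = trans (period-4 (m * 4 + k)) (period-4* m k)

  not-periodic : ∀ s → ¬ (∀ k → h (k + (4 * s + 2)) ≡ h k)
  not-periodic s periodic = clash 2 0 (all-zero 0) (all-zero 1) z≤n
    where
    around : ∀ k m → 2 + k + (4 * m + 2) ≡ 2 + (m * 4 + (2 + k))
    around = solve-∀
    gap-2 : ∀ k → h (2 + k) ≡ h (4 + k)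
    gap-2 k = trans (sym (periodic (2 + k))) (trans (cong h (around k s)) (period-4* s (2 + k)))
    all-zero : ∀ k → h (2 + k) ≡ 0F
    all-zero k with h (2 + k) Fin.≟ 0F
    ... | yes e₂  = e₂
    ... | no h₂≢0 = ⊥-elim (clash (2 + k) 1 refl (sym (gap-2 k)) (toℕ-≢zero h₂≢0))

module _ {n : ℕ} .{{_ : NonZero n}} where

  suc-% : ∀ k → suc k % n ≡ suc (k % n) % n
  suc-% k = trans (%-distribˡ-+ 1 k n)
                  (sym (trans (%-distribˡ-+ 1 (k % n) n) (cong (λ r → (1 % n + r) % n) (m%n%n≡m%n k n))))

  %-suc : ∀ k → suc k % n ≡ suc (k % n) ⊎ (k % n ≡ n ∸ 1 × suc k % n ≡ 0)
  %-suc k with <-cmp (suc (k % n)) n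
  ... | tri< 1+r<n _ _ = inj₁ (trans (suc-% k) (m<n⇒m%n≡m 1+r<n))
  ... | tri≈ _ 1+r≡n _ =
    inj₂ (cong (_∸ 1) 1+r≡n , trans (suc-% k) (trans (cong (_% n) 1+r≡n) (n%n≡0 n)))
  ... | tri> _ _ n<1+r = ⊥-elim (<⇒≱ (m%n<n k n) (≤-pred n<1+r))

  %-gap : ∀ k d → 0 < d → d < n → (d + k) % n ≢ k % n
  %-gap k d 0<d d<n same = <⇒≱ d<n (∣⇒≤ {{>-nonZero 0<d}} (divides (q₁ ∸ q₀) d≡[q₁∸q₀]*n))
    where
    q₀ q₁ : ℕ
    q₀ = k / n
    q₁ = (d + k) / n
    d≡[q₁∸q₀]*n : d ≡ (q₁ ∸ q₀) * n
    d≡[q₁∸q₀]*n = begin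
      d                                        ≡⟨ m+n∸n≡m d k ⟨
      d + k ∸ k                                ≡⟨ cong₂ _∸_ (m≡m%n+[m/n]*n (d + k) n) (m≡m%n+[m/n]*n k n) ⟩
      (d + k) % n + q₁ * n ∸ (k % n + q₀ * n)  ≡⟨ cong (λ r → r + q₁ * n ∸ (k % n + q₀ * n)) same ⟩
      k % n + q₁ * n ∸ (k % n + q₀ * n)        ≡⟨ [m+n]∸[m+o]≡n∸o (k % n) _ _ ⟩
      q₁ * n ∸ q₀ * n                          ≡⟨ *-distribʳ-∸ n q₁ q₀ ⟨
      (q₁ ∸ q₀) * n                            ∎
      where open ≡-Reasoning

module CopyZero (q ℓ n : ℕ) (3<n : 3 < n) where

  private
    instance
      n-nonZero : NonZero n
      n-nonZero = >-nonZero (≤-<-trans z≤n 3<n)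

    G : Graph
    G = PathCycleProduct (suc q) ℓ n

  position : ℕ → Fin (suc q) × Fin n
  position k = 0F , fromℕ< (m%n<n k n)

  position-step : ∀ k → Adj G (position k) (position (suc k))
  position-step k = inj₁ (cyc 0F _ _ (subst₂ Step (sym (toℕ-fromℕ< _)) (sym (toℕ-fromℕ< _)) (%-suc k)))
    where Step : ℕ → ℕ → Set
          Step a b = b ≡ suc a ⊎ (a ≡ n ∸ 1 × b ≡ 0)

  position-walk : ∀ k d → Walk G (position k) (position (d + k)) d
  position-walk k zero    = nil
  position-walk k (suc d) =
    cons (position-step k)
      (subst (λ m → Walk G (position (suc k)) (position m) d) (+-suc d k) (position-walk (suc k) d))

  position-+n : ∀ k → position (k + n) ≡ position k
  position-+n k =
    cong (0F ,_) (toℕ-injective (trans (toℕ-fromℕ< _) (trans ([m+n]%n≡m%n k n) (sym (toℕ-fromℕ< _)))))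

  position-gap : ∀ k d → 0 < d → d < n → position k ≢ position (d + k)
  position-gap k d 0<d d<n same =
    %-gap k d 0<d d<n
      (trans (sym (toℕ-fromℕ< _)) (trans (cong (toℕ ∘ proj₂) (sym same)) (toℕ-fromℕ< _)))

  packing⇒path-packing : ∀ {c} → IsPackingColoring G 3 c → IsPathPacking (c ∘ position)
  packing⇒path-packing {c} packing i d d≤c same =
    packing (position i) (position (suc d + i)) (position-gap i (suc d) (s≤s z≤n) gap<n) same
      (suc d) (s≤s (s≤s d≤c)) (position-walk i (suc d))
    where gap<n : suc d < n
          gap<n = ≤-<-trans (s≤s (≤-trans d≤c (≤-pred (toℕ<n (c (position i)))))) 3<n

no-packing-3-colouring : ∀ q ℓ s → 1 ≤ s → ¬ PackingColorable (PathCycleProduct (suc q) ℓ (4 * s + 2)) 3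
no-packing-3-colouring q ℓ s 1≤s (c , packing) =
  not-periodic (packing⇒path-packing packing) s (λ k → cong c (position-+n k))
  where open CopyZero q ℓ (4 * s + 2) (≤-trans (from-yes (4 ≤? 6)) (+-monoˡ-≤ 2 (*-monoʳ-≤ 4 1≤s)))

theorem9 : (t s : ℕ) → 1 ≤ t → 2 ≤ s →
    (t ≤ 3 → χp≤ (P3t◇C t (4 * s + 2)) 4 × χp≡ (P3t◇C t (4 * s + 2)) 4) ×
    (4 ≤ t → χp≤ (P3t◇C t (4 * s + 2)) 5)
theorem9 zero _ () _
theorem9 t@(suc q) s _ 2≤s =
  (λ t≤3 → C-copies-packing t t≤3 , C-copies-packing t t≤3 , below-four) , λ _ → AB-copies-packing t
  where
  open UpperBound s 2≤s
  below-four : ∀ j → j < 4 → ¬ PackingColorable (P3t◇C t (4 * s + 2)) j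
  below-four j j<4 = no-packing-3-colouring q 3 s (<⇒≤ 2≤s) ∘ PackingColorable-mono _ (≤-pred j<4)
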